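{- Let $\mathcal{M}$ be a nonstandard model of $\mathsf{PA}$. (1) If $\mathcal{U}$ is a nonprincipal ultrafilter of $\mathrm{SSy}(\mathcal{M})$, then $\mathcal{N}=\mathcal{M}^\omega/\mathcal{U}$ is a humble extension of $\mathcal{M}$ generated over $\mathcal{M}$ by $[\mathrm{id}_M]$. (2) If $\mathcal{N}$ is a humble extension of $\mathcal{M}$ generated over $\mathcal{M}$ by an element $c$ that fills the standard cut of $\mathcal{M}$, then there is an isomorphism $f:\mathcal{N}\to\mathcal{M}^\omega/\mathcal{U}_c$ that fixes $M$ pointwise and satisfies $f(c)=[\mathrm{id}_M]$.
   Context: $\mathrm{Def}(\mathcal{M})$ is the set of parametrically definable subsets of $M$; for nonstandard $\mathcal{M}$, $\mathrm{SSy}(\mathcal{M})=\{X\cap\omega:X\in\mathrm{Def}(\mathcal{M})\}$, a Boolean subalgebra of $\mathcal{P}(\omega)$; an ultrafilter of $\mathrm{SSy}(\mathcal{M})$ is an ultrafilter of this Boolean algebra. An element $c\in N$ generates $\mathcal{N}\succ\mathcal{M}$ over $\mathcal{M}$ if every element of $N$ is $t^{\mathcal{N}}(c)$ for an $\mathcal{M}$-definable $t:M\to M$. $c$ fills the standard cut of $\mathcal{M}$ if $\{a\in M:\mathcal{N}\models a<c\}=\omega$. $\mathcal{N}$ is a humble extension of $\mathcal{M}$ if $\mathcal{M}\prec\mathcal{N}$ and $\mathcal{N}$ is generated over $\mathcal{M}$ by an element filling the standard cut of $\mathcal{M}$. For an ultrafilter $\mathcal{U}$ of $\mathrm{SSy}(\mathcal{M})$: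 let $T$ be the set of $\mathcal{M}$-definable functions $t:M\to M$, put $t_1\sim t_2$ iff $\{n<\omega:t_1(n)=t_2(n)\}\in\mathcal{U}$, let $[t]$ be the class of $t$; $\mathcal{M}^\omega/\mathcal{U}$ is the structure with domain $\{[t]:t\in T\}$ such that for each $\mathcal{L}$-formula $\varphi$, $\mathcal{M}^\omega/\mathcal{U}\models\varphi([t_0],\dots,[t_{j-1}])$ iff $\{n<\omega:\mathcal{M}\models\varphi(t_0(n),\dots,t_{j-1}(n))\}\in\mathcal{U}$; $M$ is identified with the classes of constant functions, making $\mathcal{M}\preccurlyeq\mathcal{M}^\omega/\mathcal{U}$. $\mathrm{id}_M$ is the identity function on $M$. For $c$ as in (2), $\mathcal{U}_c=\{X\cap\omega: X\in\mathrm{Def}(\mathcal{M}), c\in X^{\mathcal{N}}\}$, where $X^{\mathcal{N}}$ is the subset of $N$ defined in $\mathcal{N}$ by the same definition (with the same parameters) as $X$ in $\mathcal{M}$. -}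

module Defs where

open import Data.Nat using (ℕ; zero; suc) renaming (_+_ to _+ℕ_)
open import Data.Fin using (Fin; zero; suc; _↑ˡ_; _↑ʳ_; splitAt)
open import Data.Fin.Properties using (splitAt-↑ˡ; splitAt-↑ʳ)
open import Data.Vec.Functional using (_∷_; _++_; [])
open import Data.Product using (Σ; _×_; _,_; proj₁; proj₂)
open import Data.Sum using (_⊎_; inj₁; inj₂)
open import Data.Empty using (⊥)
open import Data.Unit using (⊤)
open import Function using (_∘_; id)
open import Relation.Nullary using (¬_)
open import Relation.Binary.PropositionalEquality
  using (_≡_; refl; sym; cong; cong₂; subst₂)

infix 1 _⟺_
_⟺_ : Set → Set → Set
A ⟺ B = (A → B) × (B → A)

-- The first-order language L_A = {0, 1, +, ·, <} of arithmetic
-- (with equality), de Bruijn variables: a formula of type Fm n has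
-- free variables among var 0 … var (n-1).

infixl 7 _`*_
infixl 6 _`+_
infix 4 _`=_ _`<_
infixr 3 _`∧_
infixr 2 _`∨_
infixr 1 _`→_

data Term (n : ℕ) : Set where
  var  : Fin n → Term n
  `0 `1 : Term n
  _`+_ _`*_ : Term n → Term n → Term n

data Fm (n : ℕ) : Set where
  _`=_ _`<_ : Term n → Term n → Fm n
  `⊥ : Fm n
  _`∧_ _`∨_ _`→_ : Fm n → Fm n → Fm n
  `∀ `∃ : Fm (suc n) → Fm n

-- L_A-structures (equality symbol interpreted by a relation _≈_; in a
-- model of PA it is required to be a congruence, see IsPA).

record Structure : Set₁ where
  infix 4 _≈_ _<_
  infixl 6 _+_
  infixl 7 _*_
  field
    Carrier : Set
    _≈_ _<_ : Carrier → Carrier → Set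
    𝟘 𝟙     : Carrier
    _+_ _*_ : Carrier → Carrier → Carrier

open Structure public using (Carrier)

module _ (M : Structure) where
  open Structure M renaming (Carrier to C)

  evalT : ∀ {n} → (Fin n → C) → Term n → C
  evalT ρ (var i)  = ρ i
  evalT ρ `0       = 𝟘
  evalT ρ `1       = 𝟙
  evalT ρ (a `+ b) = evalT ρ a + evalT ρ b
  evalT ρ (a `* b) = evalT ρ a * evalT ρ b

  Sat : ∀ {n} → Fm n → (Fin n → C) → Set
  Sat (a `= b) ρ = evalT ρ a ≈ evalT ρ b
  Sat (a `< b) ρ = evalT ρ a < evalT ρ b
  Sat `⊥ ρ       = ⊥
  Sat (φ `∧ ψ) ρ = Sat φ ρ × Sat ψ ρ
  Sat (φ `∨ ψ) ρ = Sat φ ρ ⊎ Sat ψ ρ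
  Sat (φ `→ ψ) ρ = Sat φ ρ → Sat ψ ρ
  Sat (`∀ φ) ρ   = (x : C) → Sat φ (x ∷ ρ)
  Sat (`∃ φ) ρ   = Σ C λ x → Sat φ (x ∷ ρ)

  num : ℕ → C
  num zero    = 𝟘
  num (suc n) = num n + 𝟙

  record EqLaws : Set where
    field
      ≈-refl  : ∀ x → x ≈ x
      ≈-sym   : ∀ {x y} → x ≈ y → y ≈ x
      ≈-trans : ∀ {x y z} → x ≈ y → y ≈ z → x ≈ z
      +-cong  : ∀ {x x′ y y′} → x ≈ x′ → y ≈ y′ → x + y ≈ x′ + y′
      *-cong  : ∀ {x x′ y y′} → x ≈ x′ → y ≈ y′ → x * y ≈ x′ * y′
      <-cong  : ∀ {x x′ y y′} → x ≈ x′ → y ≈ y′ → x < y → x′ < y′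

  -- M ⊨ PA : equality axioms, PA⁻ (Kaye, Models of PA, §2.1) and the
  -- induction schema for all formulas with parameters.
  record IsPA : Set where
    field
      eqLaws : EqLaws
      ax1  : ∀ x y z → (x + y) + z ≈ x + (y + z)
      ax2  : ∀ x y → x + y ≈ y + x
      ax3  : ∀ x y z → (x * y) * z ≈ x * (y * z)
      ax4  : ∀ x y → x * y ≈ y * x
      ax5  : ∀ x y z → x * (y + z) ≈ x * y + x * z
      ax6  : ∀ x → (x + 𝟘 ≈ x) × (x * 𝟘 ≈ 𝟘)
      ax7  : ∀ x → x * 𝟙 ≈ x
      ax8  : ∀ x y z → x < y × y < z → x < z
      ax9  : ∀ x → ¬ (x < x)
      ax10 : ∀ x y → x < y ⊎ (x ≈ y ⊎ y < x)
      ax11 : ∀ x y z → x < y → x + z < y + z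
      ax12 : ∀ x y z → 𝟘 < z × x < y → x * z < y * z
      ax13 : ∀ x y → x < y → Σ C λ z → x + z ≈ y
      ax14 : 𝟘 < 𝟙 × (∀ x → 𝟘 < x → 𝟙 < x ⊎ 𝟙 ≈ x)
      ax15 : ∀ x → 𝟘 < x ⊎ 𝟘 ≈ x
      induction : ∀ {k} (φ : Fm (suc k)) (p : Fin k → C) →
        Sat φ (𝟘 ∷ p) → (∀ x → Sat φ (x ∷ p) → Sat φ ((x + 𝟙) ∷ p)) →
        ∀ x → Sat φ (x ∷ p)

  Nonstandard : Set
  Nonstandard = Σ C λ a → ∀ n → ¬ (a ≈ num n)

  record DefFun : Set where
    constructor deffun
    field
      arity  : ℕ
      graph  : Fm (suc (suc arity))
      params : Fin arity → C
      fun    : C → C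
      spec   : ∀ x y → Sat graph (x ∷ y ∷ params) ⟺ (y ≈ fun x)

  InSSy : (ℕ → Set) → Set
  InSSy P = Σ ℕ λ k → Σ (Fm (suc k)) λ φ → Σ (Fin k → C) λ p →
              ∀ n → P n ⟺ Sat φ (num n ∷ p)

  record IsUltrafilter (U : (ℕ → Set) → Set) : Set₁ where
    field
      inSSy : ∀ {P} → U P → InSSy P
      top   : U (λ _ → ⊤)
      noBot : ¬ U (λ _ → ⊥)
      up    : ∀ {P Q} → InSSy Q → U P → (∀ n → P n → Q n) → U Q
      meet  : ∀ {P Q} → U P → U Q → U (λ n → P n × Q n)
      ultra : ∀ {P} → InSSy P → U P ⊎ U (λ n → ¬ P n)

Nonprincipal : ((ℕ → Set) → Set) → Set
Nonprincipal U = ∀ m → ¬ U (λ n → n ≡ m)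

ext : ∀ {m n} → (Fin m → Fin n) → Fin (suc m) → Fin (suc n)
ext r zero    = zero
ext r (suc i) = suc (r i)

renT : ∀ {m n} → (Fin m → Fin n) → Term m → Term n
renT r (var i)  = var (r i)
renT r `0       = `0
renT r `1       = `1
renT r (a `+ b) = renT r a `+ renT r b
renT r (a `* b) = renT r a `* renT r b

renF : ∀ {m n} → (Fin m → Fin n) → Fm m → Fm n
renF r (a `= b) = renT r a `= renT r b
renF r (a `< b) = renT r a `< renT r b
renF r `⊥       = `⊥
renF r (φ `∧ ψ) = renF r φ `∧ renF r ψ
renF r (φ `∨ ψ) = renF r φ `∨ renF r ψ
renF r (φ `→ ψ) = renF r φ `→ renF r ψ
renF r (`∀ φ)   = `∀ (renF (ext r) φ)
renF r (`∃ φ)   = `∃ (renF (ext r) φ)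

module _ (M : Structure) where
  open Structure M renaming (Carrier to C)

  evalT-ren : ∀ {m n} (r : Fin m → Fin n) (ρ : Fin n → C) (σ : Fin m → C) →
    (∀ i → ρ (r i) ≡ σ i) → ∀ t → evalT M ρ (renT r t) ≡ evalT M σ t
  evalT-ren r ρ σ h (var i)  = h i
  evalT-ren r ρ σ h `0       = refl
  evalT-ren r ρ σ h `1       = refl
  evalT-ren r ρ σ h (a `+ b) = cong₂ _+_ (evalT-ren r ρ σ h a) (evalT-ren r ρ σ h b)
  evalT-ren r ρ σ h (a `* b) = cong₂ _*_ (evalT-ren r ρ σ h a) (evalT-ren r ρ σ h b)

  private
    ext-h : ∀ {m n} (r : Fin m → Fin n) (ρ : Fin n → C) (σ : Fin m → C) →
      (∀ i → ρ (r i) ≡ σ i) → ∀ x i → (x ∷ ρ) (ext r i) ≡ (x ∷ σ) i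
    ext-h r ρ σ h x zero    = refl
    ext-h r ρ σ h x (suc i) = h i

  sat-ren : ∀ {m n} (r : Fin m → Fin n) (ρ : Fin n → C) (σ : Fin m → C) →
    (∀ i → ρ (r i) ≡ σ i) → ∀ φ → Sat M (renF r φ) ρ ⟺ Sat M φ σ
  sat-ren r ρ σ h (a `= b) =
    subst₂ _≈_ (evalT-ren r ρ σ h a) (evalT-ren r ρ σ h b) ,
    subst₂ _≈_ (sym (evalT-ren r ρ σ h a)) (sym (evalT-ren r ρ σ h b))
  sat-ren r ρ σ h (a `< b) =
    subst₂ _<_ (evalT-ren r ρ σ h a) (evalT-ren r ρ σ h b) ,
    subst₂ _<_ (sym (evalT-ren r ρ σ h a)) (sym (evalT-ren r ρ σ h b))
  sat-ren r ρ σ h `⊥ = id , id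
  sat-ren r ρ σ h (φ `∧ ψ) =
    (λ (s , t) → proj₁ (sat-ren r ρ σ h φ) s , proj₁ (sat-ren r ρ σ h ψ) t) ,
    (λ (s , t) → proj₂ (sat-ren r ρ σ h φ) s , proj₂ (sat-ren r ρ σ h ψ) t)
  sat-ren r ρ σ h (φ `∨ ψ) =
    (λ { (inj₁ s) → inj₁ (proj₁ (sat-ren r ρ σ h φ) s)
       ; (inj₂ s) → inj₂ (proj₁ (sat-ren r ρ σ h ψ) s) }) ,
    (λ { (inj₁ s) → inj₁ (proj₂ (sat-ren r ρ σ h φ) s)
       ; (inj₂ s) → inj₂ (proj₂ (sat-ren r ρ σ h ψ) s) })
  sat-ren r ρ σ h (φ `→ ψ) =
    (λ f s → proj₁ (sat-ren r ρ σ h ψ) (f (proj₂ (sat-ren r ρ σ h φ) s))) ,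
    (λ f s → proj₂ (sat-ren r ρ σ h ψ) (f (proj₁ (sat-ren r ρ σ h φ) s)))
  sat-ren r ρ σ h (`∀ φ) =
    (λ f x → proj₁ (sat-ren (ext r) (x ∷ ρ) (x ∷ σ) (ext-h r ρ σ h x) φ) (f x)) ,
    (λ f x → proj₂ (sat-ren (ext r) (x ∷ ρ) (x ∷ σ) (ext-h r ρ σ h x) φ) (f x))
  sat-ren r ρ σ h (`∃ φ) =
    (λ (x , s) → x , proj₁ (sat-ren (ext r) (x ∷ ρ) (x ∷ σ) (ext-h r ρ σ h x) φ) s) ,
    (λ (x , s) → x , proj₂ (sat-ren (ext r) (x ∷ ρ) (x ∷ σ) (ext-h r ρ σ h x) φ) s)

++-↑ˡ : ∀ {A : Set} {k₁ k₂} (p : Fin k₁ → A) (q : Fin k₂ → A) i →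
        (p ++ q) (i ↑ˡ k₂) ≡ p i
++-↑ˡ {k₁ = k₁} {k₂} p q i rewrite splitAt-↑ˡ k₁ i k₂ = refl

++-↑ʳ : ∀ {A : Set} {k₁ k₂} (p : Fin k₁ → A) (q : Fin k₂ → A) i →
        (p ++ q) (k₁ ↑ʳ i) ≡ q i
++-↑ʳ {k₁ = k₁} {k₂} p q i rewrite splitAt-↑ʳ k₁ k₂ i = refl

module _ (M : Structure) (L : EqLaws M) where
  open Structure M renaming (Carrier to C)
  open EqLaws L

  constFun : C → DefFun M
  constFun a = deffun 1 (var (suc zero) `= var (suc (suc zero))) (a ∷ [])
                      (λ _ → a) (λ x y → id , id)

  idFun : DefFun M
  idFun = deffun 0 (var (suc zero) `= var zero) [] (λ x → x) (λ x y → id , id)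

  combine : (h : ∀ {n} → Term n → Term n → Term n) (F : C → C → C) →
    (∀ {n} (ρ : Fin n → C) a b → evalT M ρ (h a b) ≡ F (evalT M ρ a) (evalT M ρ b)) →
    (∀ {x x′ y y′} → x ≈ x′ → y ≈ y′ → F x y ≈ F x′ y′) →
    DefFun M → DefFun M → DefFun M
  combine h F hF Fc (deffun k₁ φ₁ p₁ f₁ s₁) (deffun k₂ φ₂ p₂ f₂ s₂) =
    deffun (k₁ +ℕ k₂) ψ (p₁ ++ p₂) (λ x → F (f₁ x) (f₂ x)) spec
    where
      -- inner context: y₂ ∷ y₁ ∷ x ∷ y ∷ (p₁ ++ p₂)
      r₁ : Fin (suc (suc k₁)) → Fin (suc (suc (suc (suc (k₁ +ℕ k₂)))))
      r₁ zero = suc (suc zero)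
      r₁ (suc zero) = suc zero
      r₁ (suc (suc i)) = suc (suc (suc (suc (i ↑ˡ k₂))))
      r₂ : Fin (suc (suc k₂)) → Fin (suc (suc (suc (suc (k₁ +ℕ k₂)))))
      r₂ zero = suc (suc zero)
      r₂ (suc zero) = zero
      r₂ (suc (suc j)) = suc (suc (suc (suc (k₁ ↑ʳ j))))
      ψ : Fm (suc (suc (k₁ +ℕ k₂)))
      ψ = `∃ (`∃ (renF r₁ φ₁ `∧ renF r₂ φ₂ `∧
                  var (suc (suc (suc zero))) `= h (var (suc zero)) (var zero)))
      module _ (x y a b : C) where
        ρ : Fin (suc (suc (suc (suc (k₁ +ℕ k₂))))) → C
        ρ = b ∷ a ∷ x ∷ y ∷ (p₁ ++ p₂)
        h₁ : ∀ i → ρ (r₁ i) ≡ (x ∷ a ∷ p₁) i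
        h₁ zero = refl
        h₁ (suc zero) = refl
        h₁ (suc (suc i)) = ++-↑ˡ p₁ p₂ i
        h₂ : ∀ i → ρ (r₂ i) ≡ (x ∷ b ∷ p₂) i
        h₂ zero = refl
        h₂ (suc zero) = refl
        h₂ (suc (suc j)) = ++-↑ʳ p₁ p₂ j
        S₁ = sat-ren M r₁ ρ (x ∷ a ∷ p₁) h₁ φ₁
        S₂ = sat-ren M r₂ ρ (x ∷ b ∷ p₂) h₂ φ₂
        E : evalT M ρ (h (var (suc zero)) (var zero)) ≡ F a b
        E = hF ρ (var (suc zero)) (var zero)
      spec : ∀ x y → Sat M ψ (x ∷ y ∷ (p₁ ++ p₂)) ⟺ (y ≈ F (f₁ x) (f₂ x))
      spec x y =
        (λ (a , b , t₁ , t₂ , e) →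
          let a≈ = proj₁ (s₁ x a) (proj₁ (S₁ x y a b) t₁)
              b≈ = proj₁ (s₂ x b) (proj₁ (S₂ x y a b) t₂)
              e′ = subst₂ _≈_ refl (E x y a b) e
          in ≈-trans e′ (Fc a≈ b≈)) ,
        (λ e → f₁ x , f₂ x ,
               proj₂ (S₁ x y (f₁ x) (f₂ x)) (proj₂ (s₁ x (f₁ x)) (≈-refl _)) ,
               proj₂ (S₂ x y (f₁ x) (f₂ x)) (proj₂ (s₂ x (f₂ x)) (≈-refl _)) ,
               subst₂ _≈_ refl (sym (E x y (f₁ x) (f₂ x))) e)

  -- The definable ultrapower M^ω/U: elements are M-definable functions
  -- t : M → M (standing for their classes [t]); [t₁] = [t₂] iff
  -- {n < ω : t₁(n) = t₂(n)} ∈ U; operations pointwise, [t₁] < [t₂] iff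
  -- {n : t₁(n) < t₂(n)} ∈ U.  (By Łoś's theorem this is the structure
  -- whose satisfaction relation is the one described in the paper.)
  Ultrapower : ((ℕ → Set) → Set) → Structure
  Ultrapower U = record
    { Carrier = DefFun M
    ; _≈_ = λ t s → U (λ n → DefFun.fun t (num M n) ≈ DefFun.fun s (num M n))
    ; _<_ = λ t s → U (λ n → DefFun.fun t (num M n) < DefFun.fun s (num M n))
    ; 𝟘 = constFun 𝟘
    ; 𝟙 = constFun 𝟙
    ; _+_ = combine _`+_ _+_ (λ ρ a b → refl) +-cong
    ; _*_ = combine _`*_ _*_ (λ ρ a b → refl) *-cong
    }

module _ (M N : Structure) (e : Carrier M → Carrier N) where

  IsElementary : Set
  IsElementary = ∀ {n} (φ : Fm n) (ρ : Fin n → Carrier M) →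
                 Sat M φ ρ ⟺ Sat N φ (e ∘ ρ)

  Generates : Carrier N → Set
  Generates c = ∀ b → Σ (DefFun M) λ t →
    Sat N (DefFun.graph t) (c ∷ b ∷ (e ∘ DefFun.params t))

  Fills : Carrier N → Set
  Fills c = ∀ a → Structure._<_ N (e a) c ⟺ (Σ ℕ λ n → Structure._≈_ M a (num M n))

  IsHumble : Set
  IsHumble = IsElementary × Σ (Carrier N) λ c → Fills c × Generates c

  Ultrafilter-of : Carrier N → (ℕ → Set) → Set
  Ultrafilter-of c P = Σ ℕ λ k → Σ (Fm (suc k)) λ φ → Σ (Fin k → Carrier M) λ p →
    (∀ n → P n ⟺ Sat M φ (num M n ∷ p)) × Sat N φ (c ∷ (e ∘ p))

record IsIso (N N′ : Structure) (f : Carrier N → Carrier N′) : Set where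
  field
    resp-≈  : ∀ a b → Structure._≈_ N a b ⟺ Structure._≈_ N′ (f a) (f b)
    onto    : ∀ y → Σ (Carrier N) λ x → Structure._≈_ N′ (f x) y
    pres-𝟘  : Structure._≈_ N′ (f (Structure.𝟘 N)) (Structure.𝟘 N′)
    pres-𝟙  : Structure._≈_ N′ (f (Structure.𝟙 N)) (Structure.𝟙 N′)
    pres-+  : ∀ a b → Structure._≈_ N′ (f (Structure._+_ N a b)) (Structure._+_ N′ (f a) (f b))
    pres-*  : ∀ a b → Structure._≈_ N′ (f (Structure._*_ N a b)) (Structure._*_ N′ (f a) (f b))
    pres-<  : ∀ a b → Structure._<_ N a b ⟺ Structure._<_ N′ (f a) (f b)

{-# OPTIONS --safe #-}

-- (1) is Łoś's theorem for the ultrapower by M-definable functions.  Its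
-- quantifier step needs definable Skolem functions, which the least number
-- principle provides (take the least witness); [id] fills the standard cut
-- because a nonprincipal U contains every final segment of ω.
-- (2) Send t(c) to [t].  A formula with parameters from M that holds of c in N
-- has a standard witness in M: otherwise its least witness would be nonstandard,
-- hence above c, contradicting minimality in N.  So N ⊨ φ(t(c)) exactly when
-- {n : M ⊨ φ(t(n))} ∈ U_c, and t(c) ↦ [t] is an isomorphism.

module Submission where

open import Defs
open import Level using (0ℓ)
open import Axiom.ExcludedMiddle using (ExcludedMiddle)
open import Axiom.DoubleNegationElimination using (em⇒dne)
open import Data.Nat using (ℕ; zero; suc; z≤n; s≤s)
  renaming (_+_ to _+ℕ_; _<_ to _<ℕ_; _≤_ to _≤ℕ_)
open import Data.Nat.Properties using (m≤n⇒m<n∨m≡n; <-cmp; <⇒≱; ≮⇒≥; ≤∧≢⇒<)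
open import Data.Fin using (Fin; zero; suc; _↑ˡ_; _↑ʳ_; splitAt)
open import Data.Vec.Functional using (_∷_; _++_; [])
open import Data.Vec.Functional.Properties using (++-cong)
open import Data.Product using (Σ; _×_; _,_; proj₁; proj₂)
open import Data.Sum using (_⊎_; inj₁; inj₂; [_,_]′)
open import Data.Empty using (⊥; ⊥-elim)
open import Function using (_∘_; id)
open import Relation.Binary.Definitions using (tri<; tri≈; tri>)
open import Relation.Nullary using (¬_; Dec; yes; no)
open import Relation.Binary.PropositionalEquality
  using (_≡_; _≗_; refl; sym; trans; cong₂; subst₂)

⟺-sym : ∀ {A B : Set} → A ⟺ B → B ⟺ A
⟺-sym (f , g) = g , f

⟺-trans : ∀ {A B D : Set} → A ⟺ B → B ⟺ D → A ⟺ D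
⟺-trans (f , g) (h , k) = h ∘ f , g ∘ k

sat-≗ : (S : Structure) {n : ℕ} (φ : Fm n) {ρ σ : Fin n → Carrier S} →
  ρ ≗ σ → Sat S φ ρ ⟺ Sat S φ σ
sat-≗ S φ {ρ} ρ≗σ =
  ⟺-trans (⟺-sym (sat-ren S id ρ ρ (λ _ → refl) φ)) (sat-ren S id ρ _ ρ≗σ φ)

map-++ : ∀ {A B : Set} {m n} (f : A → B) (p : Fin m → A) (q : Fin n → A) →
  f ∘ (p ++ q) ≗ (f ∘ p) ++ (f ∘ q)
map-++ {m = m} f p q i with splitAt m i
... | inj₁ _ = refl
... | inj₂ _ = refl

++-↑ʳ² : ∀ {A : Set} {m n k} (q : Fin m → A) (P : Fin n → A) (p : Fin k → A) j →
  (q ++ (P ++ p)) (m ↑ʳ (n ↑ʳ j)) ≡ p j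
++-↑ʳ² q P p j = trans (++-↑ʳ q (P ++ p) _) (++-↑ʳ P p j)

private
  liftˡ : ∀ {a b} → Fin (suc a) → Fin (suc (a +ℕ b))
  liftˡ zero = zero
  liftˡ {b = b} (suc i) = suc (i ↑ˡ b)

  liftʳ : ∀ {a b} → Fin (suc b) → Fin (suc (a +ℕ b))
  liftʳ zero = zero
  liftʳ {a = a} (suc j) = suc (a ↑ʳ j)

  skip₁ : ∀ {a} → Fin (suc a) → Fin (suc (suc a))
  skip₁ zero = zero
  skip₁ (suc i) = suc (suc i)

  swap₀₁ : ∀ {a} → Fin (suc (suc a)) → Fin (suc (suc a))
  swap₀₁ zero = suc zero
  swap₀₁ (suc zero) = zero
  swap₀₁ (suc (suc j)) = suc (suc j)

  -- x ∷ y ↦ x ∷ yᵢ in the context y₂ ∷ y₁ ∷ x ∷ p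
  into-y₁ into-y₂ : ∀ {a} → Fin (suc (suc a)) → Fin (suc (suc (suc a)))
  into-y₁ zero = suc (suc zero)
  into-y₁ (suc zero) = suc zero
  into-y₁ (suc (suc j)) = suc (suc (suc j))
  into-y₂ zero = suc (suc zero)
  into-y₂ (suc zero) = zero
  into-y₂ (suc (suc j)) = suc (suc (suc j))

conj++ : ∀ {a b} → Fm (suc a) → Fm (suc b) → Fm (suc (a +ℕ b))
conj++ χ ψ = renF liftˡ χ `∧ renF liftʳ ψ

noneBelow : ∀ {a} → Fm (suc a) → Fm (suc a)
noneBelow χ = `∀ (var zero `< var (suc zero) `→ (renF skip₁ χ `→ `⊥))

functional : ∀ {a} → Fm (suc (suc a)) → Fm a
functional G =
  `∀ (`∀ (`∀ (renF into-y₁ G `→ renF into-y₂ G `→ var (suc zero) `= var zero)))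

total : ∀ {a} → Fm (suc (suc a)) → Fm a
total G = `∀ (`∃ (renF swap₀₁ G))

module _ (S : Structure) where
  open Structure S hiding (Carrier)

  sat-skip₁ : ∀ {a} (φ : Fm (suc a)) x y (q : Fin a → Carrier S) →
    Sat S (renF skip₁ φ) (x ∷ y ∷ q) ⟺ Sat S φ (x ∷ q)
  sat-skip₁ φ x y q = sat-ren S skip₁ _ _ (λ { zero → refl ; (suc i) → refl }) φ

  sat-conj++ : ∀ {a b} (χ : Fm (suc a)) (ψ : Fm (suc b)) x
    (p : Fin a → Carrier S) (q : Fin b → Carrier S) →
    Sat S (conj++ χ ψ) (x ∷ (p ++ q)) ⟺ (Sat S χ (x ∷ p) × Sat S ψ (x ∷ q))
  sat-conj++ χ ψ x p q =
    (λ (s , t) → proj₁ Sχ s , proj₁ Sψ t) , (λ (s , t) → proj₂ Sχ s , proj₂ Sψ t)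
    where
      Sχ : Sat S (renF liftˡ χ) (x ∷ (p ++ q)) ⟺ Sat S χ (x ∷ p)
      Sχ = sat-ren S liftˡ _ _ (λ { zero → refl ; (suc i) → ++-↑ˡ p q i }) χ
      Sψ : Sat S (renF liftʳ ψ) (x ∷ (p ++ q)) ⟺ Sat S ψ (x ∷ q)
      Sψ = sat-ren S liftʳ _ _ (λ { zero → refl ; (suc i) → ++-↑ʳ p q i }) ψ

  sat-noneBelow : ∀ {a} (χ : Fm (suc a)) y (q : Fin a → Carrier S) →
    Sat S (noneBelow χ) (y ∷ q) ⟺ (∀ x → x < y → ¬ Sat S χ (x ∷ q))
  sat-noneBelow χ y q =
    (λ f x x<y s → f x x<y (proj₂ (sat-skip₁ χ x y q) s)) ,
    (λ f x x<y s → f x x<y (proj₁ (sat-skip₁ χ x y q) s))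

  sat-functional : ∀ {a} (G : Fm (suc (suc a))) (p : Fin a → Carrier S) →
    Sat S (functional G) p ⟺
    (∀ x y₁ y₂ → Sat S G (x ∷ y₁ ∷ p) → Sat S G (x ∷ y₂ ∷ p) → y₁ ≈ y₂)
  sat-functional G p =
    (λ f x y₁ y₂ s t → f x y₁ y₂ (proj₂ (S₁ x y₁ y₂) s) (proj₂ (S₂ x y₁ y₂) t)) ,
    (λ f x y₁ y₂ s t → f x y₁ y₂ (proj₁ (S₁ x y₁ y₂) s) (proj₁ (S₂ x y₁ y₂) t))
    where
      S₁ : ∀ x y₁ y₂ → Sat S (renF into-y₁ G) (y₂ ∷ y₁ ∷ x ∷ p) ⟺ Sat S G (x ∷ y₁ ∷ p)
      S₁ x y₁ y₂ = sat-ren S into-y₁ _ _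
        (λ { zero → refl ; (suc zero) → refl ; (suc (suc j)) → refl }) G
      S₂ : ∀ x y₁ y₂ → Sat S (renF into-y₂ G) (y₂ ∷ y₁ ∷ x ∷ p) ⟺ Sat S G (x ∷ y₂ ∷ p)
      S₂ x y₁ y₂ = sat-ren S into-y₂ _ _
        (λ { zero → refl ; (suc zero) → refl ; (suc (suc j)) → refl }) G

  sat-total : ∀ {a} (G : Fm (suc (suc a))) (p : Fin a → Carrier S) →
    Sat S (total G) p ⟺ (∀ x → Σ (Carrier S) λ y → Sat S G (x ∷ y ∷ p))
  sat-total G p =
    (λ f x → proj₁ (f x) , proj₁ (Sw x (proj₁ (f x))) (proj₂ (f x))) ,
    (λ f x → proj₁ (f x) , proj₂ (Sw x (proj₁ (f x))) (proj₂ (f x)))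
    where
      Sw : ∀ x y → Sat S (renF swap₀₁ G) (y ∷ x ∷ p) ⟺ Sat S G (x ∷ y ∷ p)
      Sw x y = sat-ren S swap₀₁ _ _
        (λ { zero → refl ; (suc zero) → refl ; (suc (suc j)) → refl }) G

-- Substituting definable functions into formulas

ΣArity : (k : ℕ) → (Fin k → ℕ) → ℕ
ΣArity zero ar = 0
ΣArity (suc k) ar = ΣArity k (λ i → ar (suc i)) +ℕ ar zero

concatParams : {A : Set} (k : ℕ) (ar : Fin k → ℕ) →
  ((i : Fin k) → Fin (ar i) → A) → Fin (ΣArity k ar) → A
concatParams zero ar π = []
concatParams (suc k) ar π = concatParams k (λ i → ar (suc i)) (λ i → π (suc i)) ++ π zero

map-concatParams : ∀ {A B : Set} (f : A → B) (k : ℕ) (ar : Fin k → ℕ)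
  (π : (i : Fin k) → Fin (ar i) → A) →
  f ∘ concatParams k ar π ≗ concatParams k ar (λ i → f ∘ π i)
map-concatParams f zero ar π ()
map-concatParams f (suc k) ar π j =
  trans (map-++ f (concatParams k _ (λ i → π (suc i))) (π zero) j)
        (++-cong _ _ (map-concatParams f k _ (λ i → π (suc i))) (λ _ → refl) j)

private
  embedQP : ∀ m A a → Fin (m +ℕ A) → Fin (m +ℕ (A +ℕ a))
  embedQP m A a j = [ (λ l → l ↑ˡ (A +ℕ a)) , (λ l → m ↑ʳ (l ↑ˡ a)) ]′ (splitAt m j)

  bindG : ∀ m A a → Fin (suc (suc a)) → Fin (suc (suc (m +ℕ (A +ℕ a))))
  bindG m A a zero = suc zero
  bindG m A a (suc zero) = zero
  bindG m A a (suc (suc j)) = suc (suc (m ↑ʳ (A ↑ʳ j)))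

  bindE : ∀ m A a → Fin (suc (suc (m +ℕ A))) → Fin (suc (suc (m +ℕ (A +ℕ a))))
  bindE m A a zero = suc zero
  bindE m A a (suc zero) = zero
  bindE m A a (suc (suc j)) = suc (suc (embedQP m A a j))

  insertAfter : ∀ k m → Fin (k +ℕ m) → Fin (k +ℕ suc m)
  insertAfter k m i = [ (λ l → l ↑ˡ suc m) , (λ l → k ↑ʳ suc l) ]′ (splitAt k i)

  rotate : ∀ k m → Fin (suc (suc k +ℕ m)) → Fin (suc (k +ℕ suc m))
  rotate k m zero = zero
  rotate k m (suc zero) = suc (k ↑ʳ zero)
  rotate k m (suc (suc i)) = suc (insertAfter k m i)

  ↑ˡ₀ : ∀ m → Fin (suc m) → Fin (suc (m +ℕ 0))
  ↑ˡ₀ m zero = zero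
  ↑ˡ₀ m (suc i) = suc (i ↑ˡ 0)

  embedQP-lookup : ∀ {C : Set} m {A a} (q : Fin m → C) (P : Fin A → C) (p : Fin a → C) y j →
    (q ++ (P ++ p)) (embedQP m A a j) ≡ ((y ∷ q) ++ P) (suc j)
  embedQP-lookup m {A} {a} q P p y j with splitAt m j
  ... | inj₁ l = ++-↑ˡ q (P ++ p) l
  ... | inj₂ l = trans (++-↑ʳ q (P ++ p) (l ↑ˡ a)) (++-↑ˡ P p l)

  insertAfter-lookup : ∀ {C : Set} k {m} (ys : Fin k → C) (q : Fin m → C) y i →
    (ys ++ (y ∷ q)) (insertAfter k m i) ≡ ((y ∷ ys) ++ q) (suc i)
  insertAfter-lookup k {m} ys q y i with splitAt k i
  ... | inj₁ l = ++-↑ˡ ys (y ∷ q) l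
  ... | inj₂ l = ++-↑ʳ ys (y ∷ q) (suc l)

-- ∃y. G(x, y, p) ∧ E(x, y, q, P), read in the context x ∷ q ++ (P ++ p)
bindGraph : ∀ {m A a} → Fm (suc (suc a)) → Fm (suc (suc (m +ℕ A))) →
  Fm (suc (m +ℕ (A +ℕ a)))
bindGraph {m} {A} {a} G E = `∃ (renF (bindG m A a) G `∧ renF (bindE m A a) E)

-- With gr i the graph of tᵢ, substFuns ψ expresses ψ(x, t₀(x), …, tₖ₋₁(x), q);
-- the parameters of all graphs are appended at the end of the context.
substFuns : (k m : ℕ) (ar : Fin k → ℕ) (gr : (i : Fin k) → Fm (suc (suc (ar i)))) →
  Fm (suc (k +ℕ m)) → Fm (suc (m +ℕ ΣArity k ar))
substFuns zero m ar gr ψ = renF (↑ˡ₀ m) ψ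
substFuns (suc k) m ar gr ψ =
  bindGraph {m} {ΣArity k (λ i → ar (suc i))} (gr zero)
    (substFuns k (suc m) (λ i → ar (suc i)) (λ i → gr (suc i)) (renF (rotate k m) ψ))

substFormula : {k : ℕ} (ar : Fin k → ℕ) (gr : (i : Fin k) → Fm (suc (suc (ar i)))) →
  Fm k → Fm (suc (ΣArity k ar))
substFormula {k} ar gr φ = substFuns k 0 ar gr (renF (λ i → suc (i ↑ˡ 0)) φ)

module _ (S : Structure) where
  private C = Carrier S

  sat-bindGraph : ∀ {m A a} (G : Fm (suc (suc a))) (E : Fm (suc (suc (m +ℕ A))))
    x (q : Fin m → C) (P : Fin A → C) (p : Fin a → C) →
    Sat S (bindGraph G E) (x ∷ (q ++ (P ++ p))) ⟺
    Σ C λ y → Sat S G (x ∷ y ∷ p) × Sat S E (x ∷ ((y ∷ q) ++ P))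
  sat-bindGraph {m} {A} {a} G E x q P p =
    (λ (y , g , s) → y , proj₁ (SG y) g , proj₁ (SE y) s) ,
    (λ (y , g , s) → y , proj₂ (SG y) g , proj₂ (SE y) s)
    where
      SG : ∀ y → Sat S (renF (bindG m A a) G) (y ∷ x ∷ (q ++ (P ++ p))) ⟺ Sat S G (x ∷ y ∷ p)
      SG y = sat-ren S (bindG m A a) _ _
        (λ { zero → refl ; (suc zero) → refl ; (suc (suc j)) → ++-↑ʳ² q P p j }) G
      SE : ∀ y → Sat S (renF (bindE m A a) E) (y ∷ x ∷ (q ++ (P ++ p))) ⟺
                 Sat S E (x ∷ ((y ∷ q) ++ P))
      SE y = sat-ren S (bindE m A a) _ _
        (λ { zero → refl ; (suc zero) → refl
           ; (suc (suc j)) → embedQP-lookup m q P p y j }) E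

  sat-rotate : ∀ k {m} (ψ : Fm (suc (suc k +ℕ m))) x y (ys : Fin k → C) (q : Fin m → C) →
    Sat S (renF (rotate k m) ψ) (x ∷ (ys ++ (y ∷ q))) ⟺ Sat S ψ (x ∷ ((y ∷ ys) ++ q))
  sat-rotate k ψ x y ys q = sat-ren S (rotate k _) _ _
    (λ { zero → refl
       ; (suc zero) → ++-↑ʳ ys (y ∷ q) zero
       ; (suc (suc i)) → insertAfter-lookup k ys q y i }) ψ

  sat-substFuns : (k m : ℕ) (ar : Fin k → ℕ) (gr : (i : Fin k) → Fm (suc (suc (ar i))))
    (π : (i : Fin k) → Fin (ar i) → C) (ψ : Fm (suc (k +ℕ m))) (x : C) (q : Fin m → C) →
    Sat S (substFuns k m ar gr ψ) (x ∷ (q ++ concatParams k ar π)) ⟺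
    Σ (Fin k → C) λ ys → (∀ i → Sat S (gr i) (x ∷ ys i ∷ π i)) × Sat S ψ (x ∷ (ys ++ q))
  sat-substFuns zero m ar gr π ψ x q =
    (λ s → [] , (λ ()) , proj₁ S₀ s) , (λ (_ , _ , s) → proj₂ S₀ s)
    where
      S₀ : Sat S (renF (↑ˡ₀ m) ψ) (x ∷ (q ++ [])) ⟺ Sat S ψ (x ∷ q)
      S₀ = sat-ren S (↑ˡ₀ m) _ _ (λ { zero → refl ; (suc i) → ++-↑ˡ q [] i }) ψ
  sat-substFuns (suc k) m ar gr π ψ x q =
    (λ s → let (y , g , t) = proj₁ bound s
               (ys , gs , u) = proj₁ (IH y) t
           in (y ∷ ys) , (λ { zero → g ; (suc i) → gs i }) ,
              proj₁ (sat-rotate k ψ x y ys q) u) ,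
    (λ (ys , gs , u) → proj₂ bound
       (ys zero , gs zero , proj₂ (IH (ys zero))
         ((λ i → ys (suc i)) , (λ i → gs (suc i)) ,
          proj₂ (sat-rotate k ψ x (ys zero) (λ i → ys (suc i)) q)
            (proj₂ (sat-≗ S ψ (λ { zero → refl
                                 ; (suc j) → ++-cong _ ys head∷tail (λ _ → refl) j })) u))))
    where
      P : Fin (ΣArity k (λ i → ar (suc i))) → C
      P = concatParams k (λ i → ar (suc i)) (λ i → π (suc i))
      E : Fm (suc (suc (m +ℕ ΣArity k (λ i → ar (suc i)))))
      E = substFuns k (suc m) (λ i → ar (suc i)) (λ i → gr (suc i)) (renF (rotate k m) ψ)
      bound : Sat S (bindGraph {m} {ΣArity k (λ i → ar (suc i))} (gr zero) E) (x ∷ (q ++ (P ++ π zero))) ⟺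
              Σ C λ y → Sat S (gr zero) (x ∷ y ∷ π zero) × Sat S E (x ∷ ((y ∷ q) ++ P))
      bound = sat-bindGraph {m} (gr zero) E x q P (π zero)
      IH : ∀ y → Sat S E (x ∷ ((y ∷ q) ++ P)) ⟺
        Σ (Fin k → C) λ ys → (∀ i → Sat S (gr (suc i)) (x ∷ ys i ∷ π (suc i))) ×
          Sat S (renF (rotate k m) ψ) (x ∷ (ys ++ (y ∷ q)))
      IH y = sat-substFuns k (suc m) (λ i → ar (suc i)) (λ i → gr (suc i)) (λ i → π (suc i))
               (renF (rotate k m) ψ) x (y ∷ q)
      head∷tail : ∀ {ys : Fin (suc k) → C} → ys zero ∷ (λ i → ys (suc i)) ≗ ys
      head∷tail zero = refl
      head∷tail (suc i) = refl

  sat-substFormula : ∀ {k} (ar : Fin k → ℕ) (gr : (i : Fin k) → Fm (suc (suc (ar i))))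
    (π : (i : Fin k) → Fin (ar i) → C) (φ : Fm k) x →
    Sat S (substFormula ar gr φ) (x ∷ concatParams k ar π) ⟺
    Σ (Fin k → C) λ ys → (∀ i → Sat S (gr i) (x ∷ ys i ∷ π i)) × Sat S φ ys
  sat-substFormula {k} ar gr π φ x =
    ⟺-trans (sat-substFuns k 0 ar gr π _ x [])
      ((λ (ys , g , s) → ys , g , proj₁ (drop[] ys) s) ,
       (λ (ys , g , s) → ys , g , proj₂ (drop[] ys) s))
    where
      drop[] : ∀ ys → Sat S (renF (λ i → suc (i ↑ˡ 0)) φ) (x ∷ (ys ++ [])) ⟺ Sat S φ ys
      drop[] ys = sat-ren S _ _ _ (++-↑ˡ ys []) φ

module Congruence (S : Structure) (L : EqLaws S) where
  open Structure S hiding (Carrier)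
  open EqLaws L

  ∷-cong : ∀ {n} {x y : Carrier S} {ρ σ : Fin n → Carrier S} →
    x ≈ y → (∀ i → ρ i ≈ σ i) → ∀ i → (x ∷ ρ) i ≈ (y ∷ σ) i
  ∷-cong x≈y ρ≈σ zero = x≈y
  ∷-cong x≈y ρ≈σ (suc i) = ρ≈σ i

  ++-cong≈ : ∀ {m n} {p p′ : Fin m → Carrier S} {q q′ : Fin n → Carrier S} →
    (∀ i → p i ≈ p′ i) → (∀ i → q i ≈ q′ i) → ∀ i → (p ++ q) i ≈ (p′ ++ q′) i
  ++-cong≈ {m} p≈p′ q≈q′ i with splitAt m i
  ... | inj₁ l = p≈p′ l
  ... | inj₂ l = q≈q′ l

  evalT-cong : ∀ {n} {ρ σ : Fin n → Carrier S} → (∀ i → ρ i ≈ σ i) → ∀ t →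
    evalT S ρ t ≈ evalT S σ t
  evalT-cong ρ≈σ (var i) = ρ≈σ i
  evalT-cong ρ≈σ `0 = ≈-refl _
  evalT-cong ρ≈σ `1 = ≈-refl _
  evalT-cong ρ≈σ (a `+ b) = +-cong (evalT-cong ρ≈σ a) (evalT-cong ρ≈σ b)
  evalT-cong ρ≈σ (a `* b) = *-cong (evalT-cong ρ≈σ a) (evalT-cong ρ≈σ b)

  sat-cong : ∀ {n} (φ : Fm n) {ρ σ : Fin n → Carrier S} → (∀ i → ρ i ≈ σ i) →
    Sat S φ ρ → Sat S φ σ
  sat-cong (a `= b) ρ≈σ s =
    ≈-trans (≈-sym (evalT-cong ρ≈σ a)) (≈-trans s (evalT-cong ρ≈σ b))
  sat-cong (a `< b) ρ≈σ s = <-cong (evalT-cong ρ≈σ a) (evalT-cong ρ≈σ b) s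
  sat-cong `⊥ ρ≈σ s = s
  sat-cong (φ `∧ ψ) ρ≈σ (s , t) = sat-cong φ ρ≈σ s , sat-cong ψ ρ≈σ t
  sat-cong (φ `∨ ψ) ρ≈σ (inj₁ s) = inj₁ (sat-cong φ ρ≈σ s)
  sat-cong (φ `∨ ψ) ρ≈σ (inj₂ s) = inj₂ (sat-cong ψ ρ≈σ s)
  sat-cong (φ `→ ψ) ρ≈σ f s = sat-cong ψ ρ≈σ (f (sat-cong φ (λ i → ≈-sym (ρ≈σ i)) s))
  sat-cong (`∀ φ) ρ≈σ f x = sat-cong φ (∷-cong (≈-refl x) ρ≈σ) (f x)
  sat-cong (`∃ φ) ρ≈σ (x , s) = x , sat-cong φ (∷-cong (≈-refl x) ρ≈σ) s

-- Arithmetic and definability in a model of PA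

module PA (em : ExcludedMiddle 0ℓ) (M : Structure) (pa : IsPA M) where
  open Structure M hiding (Carrier)
  open IsPA pa
  open EqLaws eqLaws
  open Congruence M eqLaws public

  C : Set
  C = Carrier M

  ≈⇒≮ : ∀ {x y} → x ≈ y → ¬ x < y
  ≈⇒≮ {x} {y} x≈y x<y = ax9 y (<-cong x≈y (≈-refl y) x<y)

  ≮𝟘 : ∀ x → ¬ x < 𝟘
  ≮𝟘 x x<0 with ax15 x
  ... | inj₁ 0<x = ax9 𝟘 (ax8 𝟘 x 𝟘 (0<x , x<0))
  ... | inj₂ 0≈x = ≈⇒≮ (≈-sym 0≈x) x<0

  +-identityˡ : ∀ y → 𝟘 + y ≈ y
  +-identityˡ y = ≈-trans (ax2 𝟘 y) (proj₁ (ax6 y))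

  x<x+𝟙 : ∀ x → x < x + 𝟙
  x<x+𝟙 x = <-cong (+-identityˡ x) (ax2 𝟙 x) (ax11 𝟘 𝟙 x (proj₁ ax14))

  -- x < y + 1 with y < x is impossible: write x = y + z with 0 < z, so 1 ≤ z
  <+𝟙⇒≤ : ∀ x y → x < y + 𝟙 → x < y ⊎ x ≈ y
  <+𝟙⇒≤ x y x<y+1 with ax10 x y
  ... | inj₁ x<y = inj₁ x<y
  ... | inj₂ (inj₁ x≈y) = inj₂ x≈y
  ... | inj₂ (inj₂ y<x) = ⊥-elim (excluded (ax13 y x y<x))
    where
      excluded : Σ C (λ z → y + z ≈ x) → ⊥
      excluded (z , y+z≈x) with ax15 z
      ... | inj₂ 0≈z = ≈⇒≮ (≈-trans (≈-sym (proj₁ (ax6 y)))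
                                    (≈-trans (+-cong (≈-refl y) 0≈z) y+z≈x)) y<x
      ... | inj₁ 0<z with proj₂ ax14 z 0<z
      ... | inj₁ 1<z = ax9 x (ax8 x (y + 𝟙) x
            (x<y+1 , <-cong (ax2 𝟙 y) (≈-trans (ax2 z y) y+z≈x) (ax11 𝟙 z y 1<z)))
      ... | inj₂ 1≈z = ≈⇒≮ (≈-sym (≈-trans (+-cong (≈-refl y) 1≈z) y+z≈x)) x<y+1

  predecessor : ∀ m → 𝟘 < m → Σ C λ p → p + 𝟙 ≈ m
  predecessor m 0<m with proj₂ ax14 m 0<m
  ... | inj₁ 1<m = let (z , 1+z≈m) = ax13 𝟙 m 1<m in z , ≈-trans (ax2 z 𝟙) 1+z≈m
  ... | inj₂ 1≈m = 𝟘 , ≈-trans (+-identityˡ 𝟙) 1≈m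

  num-< : ∀ {m n} → m <ℕ n → num M m < num M n
  num-< {m} {suc n} (s≤s m≤n) with m≤n⇒m<n∨m≡n m≤n
  ... | inj₁ m<n = ax8 _ _ _ (num-< m<n , x<x+𝟙 (num M n))
  ... | inj₂ refl = x<x+𝟙 (num M n)

  num-injective : ∀ m n → num M m ≈ num M n → m ≡ n
  num-injective m n eq with <-cmp m n
  ... | tri< m<n _ _ = ⊥-elim (≈⇒≮ eq (num-< m<n))
  ... | tri≈ _ m≡n _ = m≡n
  ... | tri> _ _ n<m = ⊥-elim (≈⇒≮ (≈-sym eq) (num-< n<m))

  <num⇒standard : ∀ n x → x < num M n → Σ ℕ λ k → x ≈ num M k
  <num⇒standard zero x x<0 = ⊥-elim (≮𝟘 x x<0)
  <num⇒standard (suc n) x x<n+1 with <+𝟙⇒≤ x (num M n) x<n+1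
  ... | inj₁ x<n = <num⇒standard n x x<n
  ... | inj₂ x≈n = n , x≈n

  Least : ∀ {a} → Fm (suc a) → (Fin a → C) → Set
  Least φ q = Σ C λ m → Sat M φ (m ∷ q) × (∀ x → x < m → ¬ Sat M φ (x ∷ q))

  least-number-principle : ∀ {a} (φ : Fm (suc a)) (q : Fin a → C) x →
    Sat M φ (x ∷ q) → Least φ q
  least-number-principle φ q x φx = em⇒dne em λ noLeast →
    proj₁ (sat-noneBelow M φ (x + 𝟙) q) (noneBelow-everywhere noLeast (x + 𝟙)) x (x<x+𝟙 x) φx
    where
      noneBelow-everywhere : ¬ Least φ q → ∀ y → Sat M (noneBelow φ) (y ∷ q)
      noneBelow-everywhere noLeast = induction (noneBelow φ) q base step
        where
          base : Sat M (noneBelow φ) (𝟘 ∷ q)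
          base = proj₂ (sat-noneBelow M φ 𝟘 q) (λ x x<0 _ → ≮𝟘 x x<0)
          step : ∀ y → Sat M (noneBelow φ) (y ∷ q) → Sat M (noneBelow φ) ((y + 𝟙) ∷ q)
          step y below = proj₂ (sat-noneBelow M φ (y + 𝟙) q) λ x x<y+1 φx →
            let below′ = proj₁ (sat-noneBelow M φ y q) below in
            [ (λ x<y → below′ x x<y φx)
            , (λ x≈y → noLeast (y , sat-cong φ (∷-cong x≈y (λ i → ≈-refl (q i))) φx , below′))
            ]′ (<+𝟙⇒≤ x y x<y+1)

  values : ∀ {k} → (Fin k → DefFun M) → C → Fin k → C
  values ρ x i = DefFun.fun (ρ i) x

  truthSet : ∀ {k} → Fm k → (Fin k → DefFun M) → ℕ → Set
  truthSet φ ρ n = Sat M φ (values ρ (num M n))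

  module Substitution {k : ℕ} (ρ : Fin k → DefFun M) where
    arities : Fin k → ℕ
    arities i = DefFun.arity (ρ i)

    graphs : (i : Fin k) → Fm (suc (suc (arities i)))
    graphs i = DefFun.graph (ρ i)

    params : (i : Fin k) → Fin (arities i) → C
    params i = DefFun.params (ρ i)

    allParams : Fin (ΣArity k arities) → C
    allParams = concatParams k arities params

    _[ρ] : Fm k → Fm (suc (ΣArity k arities))
    _[ρ] = substFormula arities graphs

    graphs-values : ∀ x i → Sat M (graphs i) (x ∷ values ρ x i ∷ params i)
    graphs-values x i = proj₂ (DefFun.spec (ρ i) x _) (≈-refl _)

    graphs⇒values : ∀ x (ys : Fin k → C) → (∀ i → Sat M (graphs i) (x ∷ ys i ∷ params i)) →
      ∀ i → ys i ≈ values ρ x i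
    graphs⇒values x ys gs i = proj₁ (DefFun.spec (ρ i) x (ys i)) (gs i)

    sat-substFuns-values : ∀ {m} (ψ : Fm (suc (k +ℕ m))) x (q : Fin m → C) →
      Sat M (substFuns k m arities graphs ψ) (x ∷ (q ++ allParams)) ⟺
      Sat M ψ (x ∷ (values ρ x ++ q))
    sat-substFuns-values {m} ψ x q =
      ⟺-trans (sat-substFuns M k m arities graphs params ψ x q)
        ((λ (ys , gs , s) →
            sat-cong ψ (∷-cong (≈-refl x) (++-cong≈ (graphs⇒values x ys gs) (≈-refl ∘ q))) s) ,
         (λ s → values ρ x , graphs-values x , s))

    sat-[ρ] : ∀ φ x → Sat M (φ [ρ]) (x ∷ allParams) ⟺ Sat M φ (values ρ x)
    sat-[ρ] φ x =
      ⟺-trans (sat-substFormula M arities graphs params φ x)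
        ((λ (ys , gs , s) → sat-cong φ (graphs⇒values x ys gs) s) ,
         (λ s → values ρ x , graphs-values x , s))

    truthSet-inSSy : ∀ φ → InSSy M (truthSet φ ρ)
    truthSet-inSSy φ = ΣArity k arities , φ [ρ] , allParams ,
                       λ n → ⟺-sym (sat-[ρ] φ (num M n))

  Witnessed : ∀ {a} → Fm (suc a) → (Fin a → C) → Set
  Witnessed φ q = Σ C λ y → Sat M φ (y ∷ q)

  leastWitness : ∀ {a} (φ : Fm (suc a)) (q : Fin a → C) → Dec (Witnessed φ q) → C
  leastWitness φ q (yes (y , φy)) = proj₁ (least-number-principle φ q y φy)
  leastWitness φ q (no _) = 𝟘

  leastWitness-sat : ∀ {a} (φ : Fm (suc a)) (q : Fin a → C) (d : Dec (Witnessed φ q)) →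
    Witnessed φ q → Sat M φ (leastWitness φ q d ∷ q)
  leastWitness-sat φ q (yes (y , φy)) _ = proj₁ (proj₂ (least-number-principle φ q y φy))
  leastWitness-sat φ q (no none) w = ⊥-elim (none w)

  leastOrZero : ∀ {a} → Fm (suc a) → Fm (suc a)
  leastOrZero φ = (φ `∧ noneBelow φ) `∨ ((`∃ (renF skip₁ φ) `→ `⊥) `∧ var zero `= `0)

  sat-leastOrZero : ∀ {a} (φ : Fm (suc a)) (q : Fin a → C) (d : Dec (Witnessed φ q)) y →
    Sat M (leastOrZero φ) (y ∷ q) ⟺ (y ≈ leastWitness φ q d)
  sat-leastOrZero φ q (yes (y₀ , φy₀)) y with least-number-principle φ q y₀ φy₀
  ... | m , φm , below = to , from
    where
      to : Sat M (leastOrZero φ) (y ∷ q) → y ≈ m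
      to (inj₁ (φy , belowy)) with ax10 y m
      ... | inj₁ y<m = ⊥-elim (below y y<m φy)
      ... | inj₂ (inj₁ y≈m) = y≈m
      ... | inj₂ (inj₂ m<y) = ⊥-elim (proj₁ (sat-noneBelow M φ y q) belowy m m<y φm)
      to (inj₂ (none , _)) = ⊥-elim (none (y₀ , proj₂ (sat-skip₁ M φ y₀ y q) φy₀))
      from : y ≈ m → Sat M (leastOrZero φ) (y ∷ q)
      from y≈m = inj₁
        ( sat-cong φ (∷-cong (≈-sym y≈m) (≈-refl ∘ q)) φm
        , proj₂ (sat-noneBelow M φ y q) (λ x x<y → below x (<-cong (≈-refl x) y≈m x<y)))
  sat-leastOrZero φ q (no none) y = to , from
    where
      to : Sat M (leastOrZero φ) (y ∷ q) → y ≈ 𝟘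
      to (inj₁ (φy , _)) = ⊥-elim (none (y , φy))
      to (inj₂ (_ , y≈0)) = y≈0
      from : y ≈ 𝟘 → Sat M (leastOrZero φ) (y ∷ q)
      from y≈0 = inj₂ ((λ (z , φz) → none (z , proj₁ (sat-skip₁ M φ z y q) φz)) , y≈0)

  private
    ↑ʳ-last : ∀ {k} → Fin (suc k) → Fin (suc (k +ℕ 1))
    ↑ʳ-last {k} zero = suc (k ↑ʳ zero)
    ↑ʳ-last (suc i) = suc (i ↑ˡ 1)

  -- The graph of x ↦ least y with φ(y, t₀(x), …), or 0 if there is none
  definableSkolem : ∀ {k} (φ : Fm (suc k)) (ρ : Fin k → DefFun M) →
    Σ (DefFun M) λ t → ∀ x → Witnessed φ (values ρ x) → Sat M φ (DefFun.fun t x ∷ values ρ x)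
  definableSkolem {k} φ ρ =
    deffun (ΣArity k arities) G allParams skolem spec ,
    λ x → leastWitness-sat φ (values ρ x) em
    where
      open Substitution ρ
      G : Fm (suc (suc (ΣArity k arities)))
      G = substFuns k 1 arities graphs (renF ↑ʳ-last (leastOrZero φ))
      skolem : C → C
      skolem x = leastWitness φ (values ρ x) em
      spec : ∀ x y → Sat M G (x ∷ y ∷ allParams) ⟺ (y ≈ skolem x)
      spec x y =
        ⟺-trans (sat-≗ M G λ { zero → refl ; (suc zero) → refl ; (suc (suc j)) → refl })
        (⟺-trans (sat-substFuns-values (renF ↑ʳ-last (leastOrZero φ)) x (y ∷ []))
        (⟺-trans (sat-ren M ↑ʳ-last _ (y ∷ values ρ x)
                    (λ { zero → ++-↑ʳ (values ρ x) (y ∷ []) zero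
                       ; (suc i) → ++-↑ˡ (values ρ x) (y ∷ []) i })
                    (leastOrZero φ))
                 (sat-leastOrZero φ (values ρ x) em y)))

module Łoś (em : ExcludedMiddle 0ℓ) (M : Structure) (pa : IsPA M)
           (U : (ℕ → Set) → Set) (uf : IsUltrafilter M U) where
  open Structure M hiding (Carrier)
  open IsPA pa
  open EqLaws eqLaws
  open PA em M pa
  open IsUltrafilter uf

  M^ω/U : Structure
  M^ω/U = Ultrapower M eqLaws U

  InSSy-⟺ : ∀ {P Q : ℕ → Set} → InSSy M P → (∀ n → P n ⟺ Q n) → InSSy M Q
  InSSy-⟺ (k , φ , p , P⟺φ) P⟺Q = k , φ , p , λ n → ⟺-trans (⟺-sym (P⟺Q n)) (P⟺φ n)

  U-⟺ : ∀ {P Q : ℕ → Set} → InSSy M Q → (∀ n → P n ⟺ Q n) → U P ⟺ U Q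
  U-⟺ ssyQ P⟺Q =
    (λ u → up ssyQ u (λ n → proj₁ (P⟺Q n))) ,
    (λ u → up (InSSy-⟺ ssyQ (λ n → ⟺-sym (P⟺Q n))) u (λ n → proj₂ (P⟺Q n)))

  U-nonempty : ∀ {P : ℕ → Set} → U P → ¬ (∀ n → ¬ P n)
  U-nonempty u empty = noBot (up (0 , `⊥ , [] , λ _ → id , id) u empty)

  fun-evalT : ∀ {k} (ρ : Fin k → DefFun M) t x →
    DefFun.fun (evalT M^ω/U ρ t) x ≡ evalT M (values ρ x) t
  fun-evalT ρ (var i) x = refl
  fun-evalT ρ `0 x = refl
  fun-evalT ρ `1 x = refl
  fun-evalT ρ (a `+ b) x = cong₂ _+_ (fun-evalT ρ a x) (fun-evalT ρ b x)
  fun-evalT ρ (a `* b) x = cong₂ _*_ (fun-evalT ρ a x) (fun-evalT ρ b x)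

  subst₂-⟺ : ∀ (R : C → C → Set) {x x′ y y′} → x ≡ x′ → y ≡ y′ → R x y ⟺ R x′ y′
  subst₂-⟺ R x≡x′ y≡y′ = subst₂ R x≡x′ y≡y′ , subst₂ R (sym x≡x′) (sym y≡y′)

  values-∷ : ∀ {k} (t : DefFun M) (ρ : Fin k → DefFun M) x →
    values (t ∷ ρ) x ≗ DefFun.fun t x ∷ values ρ x
  values-∷ t ρ x zero = refl
  values-∷ t ρ x (suc i) = refl

  truthSet-∷ : ∀ {k} (φ : Fm (suc k)) (t : DefFun M) (ρ : Fin k → DefFun M) n →
    truthSet φ (t ∷ ρ) n ⟺ Sat M φ (DefFun.fun t (num M n) ∷ values ρ (num M n))
  truthSet-∷ φ t ρ n = sat-≗ M φ (values-∷ t ρ (num M n))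

  ¬∀⇒∃¬ : ∀ {k} (φ : Fm (suc k)) (q : Fin k → C) →
    ¬ (∀ y → Sat M φ (y ∷ q)) → Witnessed (φ `→ `⊥) q
  ¬∀⇒∃¬ φ q ¬∀ = em⇒dne em λ ¬∃ → ¬∀ λ y → em⇒dne em λ ¬φy → ¬∃ (y , ¬φy)

  łoś : ∀ {k} (φ : Fm k) (ρ : Fin k → DefFun M) → Sat M^ω/U φ ρ ⟺ U (truthSet φ ρ)
  łoś (a `= b) ρ = U-⟺ (Substitution.truthSet-inSSy ρ (a `= b))
    (λ n → subst₂-⟺ _≈_ (fun-evalT ρ a (num M n)) (fun-evalT ρ b (num M n)))
  łoś (a `< b) ρ = U-⟺ (Substitution.truthSet-inSSy ρ (a `< b))
    (λ n → subst₂-⟺ _<_ (fun-evalT ρ a (num M n)) (fun-evalT ρ b (num M n)))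
  łoś `⊥ ρ = ⊥-elim , (λ u → ⊥-elim (noBot u))
  łoś (φ `∧ ψ) ρ =
    (λ (s , t) → meet (proj₁ (łoś φ ρ) s) (proj₁ (łoś ψ ρ) t)) ,
    (λ u → proj₂ (łoś φ ρ) (up (truthSet-inSSy φ) u (λ n → proj₁)) ,
           proj₂ (łoś ψ ρ) (up (truthSet-inSSy ψ) u (λ n → proj₂)))
    where open Substitution ρ
  łoś (φ `∨ ψ) ρ = to , from
    where
      open Substitution ρ
      to : Sat M^ω/U (φ `∨ ψ) ρ → U (truthSet (φ `∨ ψ) ρ)
      to (inj₁ s) = up (truthSet-inSSy (φ `∨ ψ)) (proj₁ (łoś φ ρ) s) (λ n → inj₁)
      to (inj₂ s) = up (truthSet-inSSy (φ `∨ ψ)) (proj₁ (łoś ψ ρ) s) (λ n → inj₂)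
      from : U (truthSet (φ `∨ ψ) ρ) → Sat M^ω/U (φ `∨ ψ) ρ
      from u with ultra (truthSet-inSSy φ) | ultra (truthSet-inSSy ψ)
      ... | inj₁ uφ | _ = inj₁ (proj₂ (łoś φ ρ) uφ)
      ... | inj₂ _ | inj₁ uψ = inj₂ (proj₂ (łoś ψ ρ) uψ)
      ... | inj₂ ¬uφ | inj₂ ¬uψ = ⊥-elim (U-nonempty (meet u (meet ¬uφ ¬uψ))
            λ { n (inj₁ s , ¬φ , _) → ¬φ s ; n (inj₂ s , _ , ¬ψ) → ¬ψ s })
  łoś (φ `→ ψ) ρ = to , from
    where
      open Substitution ρ
      to : Sat M^ω/U (φ `→ ψ) ρ → U (truthSet (φ `→ ψ) ρ)
      to g with ultra (truthSet-inSSy φ)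
      ... | inj₁ uφ = up (truthSet-inSSy (φ `→ ψ)) (proj₁ (łoś ψ ρ) (g (proj₂ (łoś φ ρ) uφ)))
                        (λ n s _ → s)
      ... | inj₂ ¬uφ = up (truthSet-inSSy (φ `→ ψ)) ¬uφ (λ n ¬s s → ⊥-elim (¬s s))
      from : U (truthSet (φ `→ ψ) ρ) → Sat M^ω/U (φ `→ ψ) ρ
      from u s = proj₂ (łoś ψ ρ)
        (up (truthSet-inSSy ψ) (meet u (proj₁ (łoś φ ρ) s)) (λ n (f , a) → f a))
  -- if ∀φ failed on a U-large set, a definable Skolem function for ¬φ would refute it in M^ω/U
  łoś (`∀ φ) ρ = to , from
    where
      open Substitution
      to : Sat M^ω/U (`∀ φ) ρ → U (truthSet (`∀ φ) ρ)
      to g with ultra (truthSet-inSSy ρ (`∀ φ))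
      ... | inj₁ u = u
      ... | inj₂ ¬u with definableSkolem (φ `→ `⊥) ρ
      ... | t , t-refutes = ⊥-elim (U-nonempty (meet ¬u (proj₁ (łoś φ (t ∷ ρ)) (g t)))
            λ n (¬∀ , φt) → t-refutes (num M n) (¬∀⇒∃¬ φ _ ¬∀) (proj₁ (truthSet-∷ φ t ρ n) φt))
      from : U (truthSet (`∀ φ) ρ) → Sat M^ω/U (`∀ φ) ρ
      from u t = proj₂ (łoś φ (t ∷ ρ))
        (up (truthSet-inSSy (t ∷ ρ) φ) u
            (λ n ∀φ → proj₂ (truthSet-∷ φ t ρ n) (∀φ (DefFun.fun t (num M n)))))
  łoś (`∃ φ) ρ = to , from
    where
      open Substitution
      to : Sat M^ω/U (`∃ φ) ρ → U (truthSet (`∃ φ) ρ)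
      to (t , s) = up (truthSet-inSSy ρ (`∃ φ)) (proj₁ (łoś φ (t ∷ ρ)) s)
        (λ n φt → DefFun.fun t (num M n) , proj₁ (truthSet-∷ φ t ρ n) φt)
      from : U (truthSet (`∃ φ) ρ) → Sat M^ω/U (`∃ φ) ρ
      from u with definableSkolem φ ρ
      ... | t , t-witnesses = t , proj₂ (łoś φ (t ∷ ρ))
        (up (truthSet-inSSy (t ∷ ρ) φ) u
            (λ n w → proj₂ (truthSet-∷ φ t ρ n) (t-witnesses (num M n) w)))

  constFun-elementary : IsElementary M M^ω/U (constFun M eqLaws)
  constFun-elementary φ ρ =
    (λ s → proj₂ (łoś φ (constFun M eqLaws ∘ ρ)) (up (truthSet-inSSy φ) top (λ _ _ → s))) ,
    (λ s → em⇒dne em λ ¬s → U-nonempty (proj₁ (łoś φ (constFun M eqLaws ∘ ρ)) s) (λ _ → ¬s))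
    where open Substitution (constFun M eqLaws ∘ ρ)

  idFun-generates : Generates M M^ω/U (constFun M eqLaws) (idFun M eqLaws)
  idFun-generates t = t , proj₂ (łoś (DefFun.graph t) ρ)
    (up (truthSet-inSSy (DefFun.graph t)) top
        (λ n _ → proj₁ (sat-≗ M (DefFun.graph t)
                          (λ { zero → refl ; (suc zero) → refl ; (suc (suc j)) → refl }))
                       (proj₂ (DefFun.spec t (num M n) _) (≈-refl _))))
    where
      ρ : Fin (suc (suc (DefFun.arity t))) → DefFun M
      ρ = idFun M eqLaws ∷ t ∷ (constFun M eqLaws ∘ DefFun.params t)
      open Substitution ρ

  module _ (nonprincipal : Nonprincipal U) where
    ≥-inSSy : ∀ j → InSSy M (λ n → j ≤ℕ n)
    ≥-inSSy j = 1 , (var zero `< var (suc zero) `→ `⊥) , num M j ∷ [] , λ n → to n , from n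
      where
        to : ∀ n → j ≤ℕ n → ¬ num M n < num M j
        to n j≤n n<j with <-cmp n j
        ... | tri< n<j _ _ = <⇒≱ n<j j≤n
        ... | tri≈ _ refl _ = ≈⇒≮ (≈-refl _) n<j
        ... | tri> _ _ j<n = ax9 (num M n) (ax8 _ _ _ (n<j , num-< j<n))
        from : ∀ n → ¬ num M n < num M j → j ≤ℕ n
        from n n≮j = ≮⇒≥ (λ n<j → n≮j (num-< n<j))

    ≡-inSSy : ∀ j → InSSy M (λ n → n ≡ j)
    ≡-inSSy j = 1 , (var zero `= var (suc zero)) , num M j ∷ [] ,
                λ n → (λ { refl → ≈-refl _ }) , num-injective n j

    ≥-∈U : ∀ j → U (λ n → j ≤ℕ n)
    ≥-∈U zero = up (≥-inSSy zero) top (λ n _ → z≤n)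
    ≥-∈U (suc j) with ultra (≡-inSSy j)
    ... | inj₁ u = ⊥-elim (nonprincipal j u)
    ... | inj₂ ¬u = up (≥-inSSy (suc j)) (meet (≥-∈U j) ¬u)
                      (λ n (j≤n , n≢j) → ≤∧≢⇒< j≤n (λ j≡n → n≢j (sym j≡n)))

    idFun-fills : Fills M M^ω/U (constFun M eqLaws) (idFun M eqLaws)
    idFun-fills a = to , from
      where
        to : U (λ n → a < num M n) → Σ ℕ λ n → a ≈ num M n
        to u = em⇒dne em λ nonstandard →
          U-nonempty u (λ n a<n → nonstandard (<num⇒standard n a a<n))
        from : (Σ ℕ λ n → a ≈ num M n) → U (λ n → a < num M n)
        from (m , a≈m) = up (1 , (var (suc zero) `< var zero) , a ∷ [] , λ n → id , id)
          (≥-∈U (suc m)) (λ n m<n → <-cong (≈-sym a≈m) (≈-refl _) (num-< m<n))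

    ultrapower-humble : IsHumble M M^ω/U (constFun M eqLaws)
    ultrapower-humble = constFun-elementary , idFun M eqLaws , idFun-fills , idFun-generates

-- Humble extensions are definable ultrapowers

module HumbleExtension (em : ExcludedMiddle 0ℓ) (M : Structure) (pa : IsPA M)
  (N : Structure) (e : Carrier M → Carrier N) (c : Carrier N)
  (elementary : IsElementary M N e) (fills : Fills M N e c) (generates : Generates M N e c)
  where
  open Structure M hiding (Carrier)
  open IsPA pa
  open EqLaws eqLaws
  open PA em M pa
  open Structure N using () renaming
    (Carrier to D; _≈_ to _≈ᴺ_; _<_ to _<ᴺ_; _+_ to _+ᴺ_; _*_ to _*ᴺ_; 𝟘 to 𝟘ᴺ; 𝟙 to 𝟙ᴺ)

  sat↑ : ∀ {k} (φ : Fm k) (ρ : Fin k → C) → Sat M φ ρ → Sat N φ (e ∘ ρ)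
  sat↑ φ ρ = proj₁ (elementary φ ρ)

  sat↓ : ∀ {k} (φ : Fm k) (ρ : Fin k → C) → Sat N φ (e ∘ ρ) → Sat M φ ρ
  sat↓ φ ρ = proj₂ (elementary φ ρ)

  private
    v₀ : ∀ {n} → Term (suc n)
    v₀ = var zero
    v₁ : ∀ {n} → Term (suc (suc n))
    v₁ = var (suc zero)
    v₂ : ∀ {n} → Term (suc (suc (suc n)))
    v₂ = var (suc (suc zero))
    v₃ : ∀ {n} → Term (suc (suc (suc (suc n))))
    v₃ = var (suc (suc (suc zero)))

  ≈ᴺ-refl : ∀ x → x ≈ᴺ x
  ≈ᴺ-refl = sat↑ (`∀ (v₀ `= v₀)) [] ≈-refl

  eqLawsᴺ : EqLaws N
  eqLawsᴺ = record
    { ≈-refl = ≈ᴺ-refl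
    ; ≈-sym = λ {x} {y} → sat↑ (`∀ (`∀ (v₁ `= v₀ `→ v₀ `= v₁))) [] (λ _ _ → ≈-sym) x y
    ; ≈-trans = λ {x} {y} {z} →
        sat↑ (`∀ (`∀ (`∀ (v₂ `= v₁ `→ v₁ `= v₀ `→ v₂ `= v₀)))) [] (λ _ _ _ → ≈-trans) x y z
    ; +-cong = λ {x} {x′} {y} {y′} →
        sat↑ (`∀ (`∀ (`∀ (`∀ (v₃ `= v₂ `→ v₁ `= v₀ `→ v₃ `+ v₁ `= v₂ `+ v₀))))) []
            (λ _ _ _ _ → +-cong) x x′ y y′
    ; *-cong = λ {x} {x′} {y} {y′} →
        sat↑ (`∀ (`∀ (`∀ (`∀ (v₃ `= v₂ `→ v₁ `= v₀ `→ v₃ `* v₁ `= v₂ `* v₀))))) []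
            (λ _ _ _ _ → *-cong) x x′ y y′
    ; <-cong = λ {x} {x′} {y} {y′} →
        sat↑ (`∀ (`∀ (`∀ (`∀ (v₃ `= v₂ `→ v₁ `= v₀ `→ v₃ `< v₁ `→ v₂ `< v₀))))) []
            (λ _ _ _ _ → <-cong) x x′ y y′
    }

  open EqLaws eqLawsᴺ using () renaming (≈-sym to ≈ᴺ-sym; <-cong to <ᴺ-cong)
  module Congruenceᴺ = Congruence N eqLawsᴺ

  <ᴺ-trichotomy : ∀ x y → x <ᴺ y ⊎ (x ≈ᴺ y ⊎ y <ᴺ x)
  <ᴺ-trichotomy = sat↑ (`∀ (`∀ (v₁ `< v₀ `∨ (v₁ `= v₀ `∨ v₀ `< v₁)))) [] ax10

  <ᴺ-trans : ∀ {x y z} → x <ᴺ y → y <ᴺ z → x <ᴺ z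
  <ᴺ-trans {x} {y} {z} = sat↑ (`∀ (`∀ (`∀ (v₂ `< v₁ `→ v₁ `< v₀ `→ v₂ `< v₀)))) []
    (λ a b d a<b b<d → ax8 a b d (a<b , b<d)) x y z

  GraphAt : DefFun M → D → D → Set
  GraphAt t x y = Sat N (DefFun.graph t) (x ∷ y ∷ e ∘ DefFun.params t)

  graphᴺ-functional : (t : DefFun M) → ∀ x y₁ y₂ → GraphAt t x y₁ → GraphAt t x y₂ → y₁ ≈ᴺ y₂
  graphᴺ-functional (deffun _ G p t spec) = proj₁ (sat-functional N G (e ∘ p))
    (sat↑ (functional G) p (proj₂ (sat-functional M G p) λ x y₁ y₂ s₁ s₂ →
      ≈-trans (proj₁ (spec x y₁) s₁) (≈-sym (proj₁ (spec x y₂) s₂))))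

  graphᴺ-total : (t : DefFun M) → ∀ x → Σ D λ y → GraphAt t x y
  graphᴺ-total (deffun _ G p t spec) = proj₁ (sat-total N G (e ∘ p))
    (sat↑ (total G) p (proj₂ (sat-total M G p) λ x → t x , proj₂ (spec x _) (≈-refl _)))

  -- the predecessor p of a nonstandard m is nonstandard, so c ≤ p < m
  c<nonstandard : ∀ m → (∀ n → ¬ m ≈ num M n) → c <ᴺ e m
  c<nonstandard m nonstandard = c≤p (<ᴺ-trichotomy c (e p))
    where
      0<m : 𝟘 < m
      0<m = [ id , (λ 0≈m → ⊥-elim (nonstandard 0 (≈-sym 0≈m))) ]′ (ax15 m)
      p : C
      p = proj₁ (predecessor m 0<m)
      p+1≈m : p + 𝟙 ≈ m
      p+1≈m = proj₂ (predecessor m 0<m)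
      ep<em : e p <ᴺ e m
      ep<em = sat↑ (v₀ `< v₁) (p ∷ m ∷ []) (<-cong (≈-refl p) p+1≈m (x<x+𝟙 p))
      c≤p : c <ᴺ e p ⊎ (c ≈ᴺ e p ⊎ e p <ᴺ c) → c <ᴺ e m
      c≤p (inj₁ c<p) = <ᴺ-trans c<p ep<em
      c≤p (inj₂ (inj₁ c≈p)) = <ᴺ-cong (≈ᴺ-sym c≈p) (≈ᴺ-refl (e m)) ep<em
      c≤p (inj₂ (inj₂ p<c)) = let (n , p≈n) = proj₁ (fills p) p<c in
        ⊥-elim (nonstandard (suc n) (≈-trans (≈-sym p+1≈m) (+-cong p≈n (≈-refl 𝟙))))

  -- the least witness in M is standard, since otherwise it lies above c in N
  standard-witness : ∀ {a} (χ : Fm (suc a)) (q : Fin a → C) → Sat N χ (c ∷ (e ∘ q)) →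
    Σ ℕ λ n → Sat M χ (num M n ∷ q)
  standard-witness χ q χc with sat↓ (`∃ χ) q (c , χc)
  ... | x , χx with least-number-principle χ q x χx
  ... | m , χm , below with em {Σ ℕ λ n → m ≈ num M n}
  ... | yes (n , m≈n) = n , sat-cong χ (∷-cong m≈n (≈-refl ∘ q)) χm
  ... | no nonstandard = ⊥-elim (belowᴺ c (c<nonstandard m (λ n m≈n → nonstandard (n , m≈n))) χc)
    where
      belowᴺ : ∀ x → x <ᴺ e m → ¬ Sat N χ (x ∷ (e ∘ q))
      belowᴺ = proj₁ (sat-noneBelow N χ (e m) (e ∘ q))
        (proj₁ (sat-≗ N (noneBelow χ) (λ { zero → refl ; (suc i) → refl }))
          (sat↑ (noneBelow χ) (m ∷ q) (proj₂ (sat-noneBelow M χ m q) below)))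

  Uc : (ℕ → Set) → Set
  Uc = Ultrafilter-of M N e c

  M^ω/Uc : Structure
  M^ω/Uc = Ultrapower M eqLaws Uc

  łoś-Uc : ∀ {k} (φ : Fm k) (ρ : Fin k → DefFun M) (ys : Fin k → D) →
    (∀ i → GraphAt (ρ i) c (ys i)) → Sat N φ ys ⟺ Uc (truthSet φ ρ)
  łoś-Uc {k} φ ρ ys graphs-ys = to , from
    where
      open Substitution ρ
      φ[ρ]ᴺ : Sat N (φ [ρ]) (c ∷ (e ∘ allParams)) ⟺
        Σ (Fin k → D) λ zs → (∀ i → GraphAt (ρ i) c (zs i)) × Sat N φ zs
      φ[ρ]ᴺ = ⟺-trans
        (sat-≗ N (φ [ρ]) λ { zero → refl ; (suc j) → map-concatParams e k arities params j })
        (sat-substFormula N arities graphs (λ i → e ∘ params i) φ c)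
      to : Sat N φ ys → Uc (truthSet φ ρ)
      to s = _ , φ [ρ] , allParams , (λ n → ⟺-sym (sat-[ρ] φ (num M n))) ,
             proj₂ φ[ρ]ᴺ (ys , graphs-ys , s)
      from : Uc (truthSet φ ρ) → Sat N φ ys
      from (_ , χ , q , χ⟺truth , χc) with em {Sat N (φ [ρ]) (c ∷ (e ∘ allParams))}
      ... | yes φc = let (zs , graphs-zs , s) = proj₁ φ[ρ]ᴺ φc in
        Congruenceᴺ.sat-cong φ (λ i → graphᴺ-functional (ρ i) c (zs i) (ys i)
                                          (graphs-zs i) (graphs-ys i)) s
      ... | no ¬φc with standard-witness (conj++ χ (φ [ρ] `→ `⊥)) (q ++ allParams)
                          (proj₁ (sat-≗ N (conj++ χ (φ [ρ] `→ `⊥))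
                                    λ { zero → refl ; (suc j) → sym (map-++ e q allParams j) })
                            (proj₂ (sat-conj++ N χ (φ [ρ] `→ `⊥) c (e ∘ q) (e ∘ allParams)) (χc , ¬φc)))
      ... | n , χ∧¬φ[ρ] with proj₁ (sat-conj++ M χ (φ [ρ] `→ `⊥) (num M n) q allParams) χ∧¬φ[ρ]
      ... | χn , ¬φn = ⊥-elim (¬φn (proj₂ (sat-[ρ] φ (num M n)) (proj₂ (χ⟺truth n) χn)))

  toUltrapower : D → DefFun M
  toUltrapower b = proj₁ (generates b)

  graph-toUltrapower : ∀ b → GraphAt (toUltrapower b) c b
  graph-toUltrapower b = proj₂ (generates b)

  sat⇔Uc : ∀ {k} (φ : Fm k) (bs : Fin k → D) →
    Sat N φ bs ⟺ Uc (truthSet φ (toUltrapower ∘ bs))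
  sat⇔Uc φ bs = łoś-Uc φ (toUltrapower ∘ bs) bs (graph-toUltrapower ∘ bs)

  toUltrapower-iso : IsIso N M^ω/Uc toUltrapower
  toUltrapower-iso = record
    { resp-≈ = λ a b → sat⇔Uc (v₀ `= v₁) (a ∷ b ∷ [])
    ; onto = onto
    ; pres-𝟘 = proj₁ (sat⇔Uc (v₀ `= `0) (𝟘ᴺ ∷ [])) (≈ᴺ-refl 𝟘ᴺ)
    ; pres-𝟙 = proj₁ (sat⇔Uc (v₀ `= `1) (𝟙ᴺ ∷ [])) (≈ᴺ-refl 𝟙ᴺ)
    ; pres-+ = λ a b → proj₁ (sat⇔Uc (v₀ `= v₁ `+ v₂) (a +ᴺ b ∷ a ∷ b ∷ [])) (≈ᴺ-refl (a +ᴺ b))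
    ; pres-* = λ a b → proj₁ (sat⇔Uc (v₀ `= v₁ `* v₂) (a *ᴺ b ∷ a ∷ b ∷ [])) (≈ᴺ-refl (a *ᴺ b))
    ; pres-< = λ a b → sat⇔Uc (v₀ `< v₁) (a ∷ b ∷ [])
    }
    where
      onto : ∀ t → Σ D λ x → Structure._≈_ M^ω/Uc (toUltrapower x) t
      onto t with graphᴺ-total t c
      ... | x , graph-x = x , proj₁ (łoś-Uc (v₀ `= v₁) (toUltrapower x ∷ t ∷ []) (x ∷ x ∷ [])
                                  λ { zero → graph-toUltrapower x ; (suc zero) → graph-x })
                               (≈ᴺ-refl x)

  toUltrapower-fixes-M : ∀ a →
    Structure._≈_ M^ω/Uc (toUltrapower (e a)) (constFun M eqLaws a)
  toUltrapower-fixes-M a =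
    proj₁ (łoś-Uc (v₀ `= v₁) (toUltrapower (e a) ∷ constFun M eqLaws a ∷ []) (e a ∷ e a ∷ [])
             λ { zero → graph-toUltrapower (e a) ; (suc zero) → ≈ᴺ-refl (e a) })
          (≈ᴺ-refl (e a))

  toUltrapower-c : Structure._≈_ M^ω/Uc (toUltrapower c) (idFun M eqLaws)
  toUltrapower-c =
    proj₁ (łoś-Uc (v₀ `= v₁) (toUltrapower c ∷ idFun M eqLaws ∷ []) (c ∷ c ∷ [])
             λ { zero → graph-toUltrapower c ; (suc zero) → ≈ᴺ-refl c })
          (≈ᴺ-refl c)

proposition2p3 : ExcludedMiddle 0ℓ →
    (M : Structure) (pa : IsPA M) → Nonstandard M →
    ((U : (ℕ → Set) → Set) → IsUltrafilter M U → Nonprincipal U →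
      IsHumble M (Ultrapower M (IsPA.eqLaws pa) U) (constFun M (IsPA.eqLaws pa))
      × Generates M (Ultrapower M (IsPA.eqLaws pa) U) (constFun M (IsPA.eqLaws pa))
          (idFun M (IsPA.eqLaws pa)))
    ×
    ((N : Structure) (e : Carrier M → Carrier N) (c : Carrier N) →
      IsElementary M N e → Fills M N e c → Generates M N e c →
      Σ (Carrier N → Carrier (Ultrapower M (IsPA.eqLaws pa) (Ultrafilter-of M N e c))) λ f →
        IsIso N (Ultrapower M (IsPA.eqLaws pa) (Ultrafilter-of M N e c)) f
        × (∀ a → Structure._≈_ (Ultrapower M (IsPA.eqLaws pa) (Ultrafilter-of M N e c))
                   (f (e a)) (constFun M (IsPA.eqLaws pa) a))
        × Structure._≈_ (Ultrapower M (IsPA.eqLaws pa) (Ultrafilter-of M N e c))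
              (f c) (idFun M (IsPA.eqLaws pa)))
proposition2p3 em M pa _ =
  (λ U uf nonprincipal → let open Łoś em M pa U uf in
    ultrapower-humble nonprincipal , idFun-generates) ,
  (λ N e c elementary fills generates →
    let open HumbleExtension em M pa N e c elementary fills generates in
    toUltrapower , toUltrapower-iso , toUltrapower-fixes-M , toUltrapower-c)
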